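{- Let $(P,\le)$ be a poset, let $\sigma(P)$ denote the set of all countably generated ideals of $P$ ordered by inclusion, and let $W\subseteq\sigma(P)$. Suppose $T\subseteq P$ is a metric tree (with the order inherited from $P$) such that (1) every level of $T$ is a maximal antichain in $P$, and (2) for every branch $I$ of $T$, the ideal of $P$ generated by $I$ belongs to $W$. If $W$ is a final segment of $\sigma(P)$ (i.e. $I\in W$, $J\in\sigma(P)$ and $I\subseteq J$ imply $J\in W$), then Odd has a winning strategy in the Banach–Mazur game $\mathrm{BM}(P,W)$.
   Context: An ideal of a poset $P$ is a set $I\subseteq P$ such that for all $x,y\in I$ there is $z\in I$ with $x\le z$ and $y\le z$, and such that $x\in I$, $y\le x$ imply $y\in I$. An ideal is countably generated if it has a countable cofinal subset. The Banach–Mazur game $\mathrm{BM}(P,W)$: Eve and Odd alternately choose elements $u_0\le u_1\le u_2\le\cdots$ of $P$, Eve choosing $u_n$ for even $n$ (starting with arbitrary $u_0$) and Odd for odd $n$, each move $\ge$ the previous one; Odd wins if the ideal generated by $(u_n)$ belongs to $W$, otherwise Eve wins. A tree is a poset in which the set of predecessors of each element is well-ordered; levels are sets of elements of a fixed height (order type of predecessors); a metric tree is a tree of height $\omega$; a branch is a maximal chain. Elements $a,b$ are compatible if they have a common upper bound in $P$; an antichain consists of pairwise incompatible elements and is maximal if every other element of $P$ is compatible with one of its elements. -}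

module Defs where

open import Level using (Level; _⊔_)
open import Data.Nat using (ℕ; suc; _*_)
open import Data.Fin as Fin using (Fin; toℕ)
open import Data.Maybe using (Maybe; just)
open import Data.Product using (Σ; ∃; _×_; _,_)
open import Data.Sum using (_⊎_)
open import Relation.Nullary using (¬_)
open import Relation.Binary.PropositionalEquality using (_≡_)
open import Relation.Binary.Bundles using (Poset)
open import Relation.Unary using (Pred; _∈_; _⊆_)

module _ {ℓ : Level} (P : Poset ℓ ℓ ℓ) where
  open Poset P

  _<ₚ_ : Carrier → Carrier → Set ℓ
  x <ₚ y = x ≤ y × ¬ (x ≈ y)

  IsIdeal : Pred Carrier ℓ → Set ℓ
  IsIdeal I = (∀ x y → I x → I y → Σ Carrier λ z → I z × x ≤ z × y ≤ z)
            × (∀ x y → I x → y ≤ x → I y)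

  -- a subset is countable: it is the set of values of some ℕ → Maybe Carrier
  -- (Maybe allows finite and empty subsets)
  Countable : Pred Carrier ℓ → Set ℓ
  Countable C = Σ (ℕ → Maybe Carrier) λ f →
      (∀ n x → f n ≡ just x → C x) × (∀ x → C x → ∃ λ n → f n ≡ just x)

  Cofinal : Pred Carrier ℓ → Pred Carrier ℓ → Set ℓ
  Cofinal C I = (C ⊆ I) × (∀ x → I x → Σ Carrier λ c → C c × x ≤ c)

  CountablyGeneratedIdeal : Pred Carrier ℓ → Set (Level.suc ℓ)
  CountablyGeneratedIdeal I =
    IsIdeal I × Σ (Pred Carrier ℓ) λ C → Countable C × Cofinal C I

  -- the ideal generated by a subset (the downward closure; used for chains)
  GenBy : Pred Carrier ℓ → Pred Carrier ℓ
  GenBy I x = Σ Carrier λ y → I y × x ≤ y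

  Compatible : Carrier → Carrier → Set ℓ
  Compatible a b = Σ Carrier λ c → a ≤ c × b ≤ c

  -- pairwise incompatible: distinct elements are incompatible
  -- (stated contrapositively: compatible elements of A are equal)
  IsAntichain : Pred Carrier ℓ → Set ℓ
  IsAntichain A = ∀ x y → A x → A y → Compatible x y → x ≈ y

  IsMaximalAntichain : Pred Carrier ℓ → Set ℓ
  IsMaximalAntichain A =
    IsAntichain A × (∀ p → Σ Carrier λ a → A a × Compatible p a)

  -- trees inside P (inherited order).  t ∈ T has height n iff its set of
  -- strict predecessors in T is a well-ordered set of order type n, i.e.
  -- it is enumerated by a strictly increasing f : Fin n → Carrier.
  HasHeight : Pred Carrier ℓ → ℕ → Carrier → Set ℓ
  HasHeight T n t = Σ (Fin n → Carrier) λ f →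
      (∀ i → T (f i) × f i <ₚ t)
    × (∀ i j → i Fin.< j → f i <ₚ f j)
    × (∀ s → T s → s <ₚ t → Σ (Fin n) λ i → s ≈ f i)

  LevelOf : Pred Carrier ℓ → ℕ → Pred Carrier ℓ
  LevelOf T n t = T t × HasHeight T n t

  -- T is a tree of height ω: predecessor sets of all elements are finite
  -- well-orders (so T is a tree with all heights < ω), and heights are
  -- unbounded (every level is nonempty), so the height of T is exactly ω.
  IsMetricTree : Pred Carrier ℓ → Set ℓ
  IsMetricTree T = (∀ t → T t → Σ ℕ λ n → HasHeight T n t)
                 × (∀ n → Σ Carrier λ t → LevelOf T n t)

  IsChainIn : Pred Carrier ℓ → Pred Carrier ℓ → Set ℓ
  IsChainIn T I = (I ⊆ T) × (∀ x y → I x → I y → x ≤ y ⊎ y ≤ x)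

  IsBranch : Pred Carrier ℓ → Pred Carrier ℓ → Set (Level.suc ℓ)
  IsBranch T I = IsChainIn T I × (∀ J → IsChainIn T J → I ⊆ J → J ⊆ I)

  IsFinalSegment : ∀ {ℓ'} → Pred (Pred Carrier ℓ) ℓ' → Set (Level.suc ℓ ⊔ ℓ')
  IsFinalSegment W = ∀ I J → W I → CountablyGeneratedIdeal J → I ⊆ J → W J

  -- Banach–Mazur game BM(P,W).  Positions before Odd's move number 2n+1
  -- are the moves u₀ … u_{2n}.  A strategy for Odd maps such a position
  -- to a move ≥ the last move u_{2n}.
  OddStrategy : Set ℓ
  OddStrategy = Σ ((n : ℕ) → (Fin (suc (2 * n)) → Carrier) → Carrier) λ σ →
    ∀ n (h : Fin (suc (2 * n)) → Carrier) → h (Fin.fromℕ (2 * n)) ≤ σ n h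

  PlayIdeal : (ℕ → Carrier) → Pred Carrier ℓ
  PlayIdeal u x = Σ ℕ λ n → x ≤ u n

  FollowsStrategy : OddStrategy → (ℕ → Carrier) → Set ℓ
  FollowsStrategy (σ , _) u =
      (∀ n → u n ≤ u (suc n))
    × (∀ n → u (suc (2 * n)) ≡ σ n (λ i → u (toℕ i)))

  OddWinningStrategy : ∀ {ℓ'} → Pred (Pred Carrier ℓ) ℓ' → OddStrategy → Set (ℓ ⊔ ℓ')
  OddWinningStrategy W s = ∀ u → FollowsStrategy s u → W (PlayIdeal u)

  OddWins : ∀ {ℓ'} → Pred (Pred Carrier ℓ) ℓ' → Set (ℓ ⊔ ℓ')
  OddWins W = Σ OddStrategy λ s → OddWinningStrategy W s

-- Odd answers Eve's n-th move with an upper bound of it and of some node t_n on the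
-- n-th level of T, which exists because that level is a maximal antichain.  Since
-- levels are antichains, a node compatible with a node of a higher level lies below
-- it; the nodes of T in the resulting ideal D are pairwise compatible, so T ∩ D is a
-- chain, and as it meets every level (in t_n) it cannot be extended: it is a branch.
-- Its generated ideal is in W and contained in D, and D is countably generated by the
-- moves, so D ∈ W because W is a final segment.
module Submission where

open import Defs
open import Level using (Level)
open import Data.Nat as ℕ using (ℕ; suc; _*_)
open import Data.Nat.Properties using (≤⇒≤′; ≤-total; m≤n⇒m<n∨m≡n; m≤m+n; m≤n+m)
open import Data.Fin as Fin using (Fin; toℕ; fromℕ<; inject≤)
open import Data.Fin.Properties
  using (toℕ<n; toℕ≤n; toℕ-inject≤; toℕ-fromℕ<; toℕ-injective; <-cmp)
open import Data.Maybe using (just)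
open import Data.Product using (Σ; _×_; _,_; proj₁; proj₂)
open import Data.Sum using (_⊎_; inj₁; inj₂)
open import Data.Empty using (⊥-elim)
open import Relation.Binary.Bundles using (Poset)
open import Relation.Binary.Definitions using (tri<; tri≈; tri>)
open import Relation.Binary.PropositionalEquality as ≡ using (_≡_; subst; subst₂)
open import Relation.Unary using (Pred; _⊆_; _∩_)
import Relation.Binary.Properties.Poset as PosetProperties

module _ {ℓ : Level} (P : Poset ℓ ℓ ℓ) where
  open Poset P renaming (refl to ≤-refl)
  open PosetProperties P using (<-trans; <⇒≉; <⇒≱)

  Predense : Pred Carrier ℓ → Set ℓ
  Predense A = ∀ p → Σ Carrier λ a → A a × Compatible P p a

  IsMaximalAntichain⇒Predense : ∀ {A} → IsMaximalAntichain P A → Predense A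
  IsMaximalAntichain⇒Predense = proj₂

  module _ {T : Pred Carrier ℓ} where

    HasHeight-predecessor : ∀ {k t} ((f , _) : HasHeight P T k t) (i : Fin k) →
                            HasHeight P T (toℕ i) (f i)
    HasHeight-predecessor {k} (f , below , increasing , complete) i =
      g , g-below , g-increasing , g-complete
      where
      embed : Fin (toℕ i) → Fin k
      embed j = inject≤ j (toℕ≤n i)

      toℕ-embed : ∀ j → toℕ (embed j) ≡ toℕ j
      toℕ-embed j = toℕ-inject≤ j (toℕ≤n i)

      g : Fin (toℕ i) → Carrier
      g j = f (embed j)

      g-below : ∀ j → T (g j) × _<ₚ_ P (g j) (f i)
      g-below j = proj₁ (below (embed j)) ,
                  increasing (embed j) i (subst (ℕ._< toℕ i) (≡.sym (toℕ-embed j)) (toℕ<n j))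

      g-increasing : ∀ a b → a Fin.< b → _<ₚ_ P (g a) (g b)
      g-increasing a b a<b =
        increasing (embed a) (embed b) (subst₂ ℕ._<_ (≡.sym (toℕ-embed a)) (≡.sym (toℕ-embed b)) a<b)

      g-complete : ∀ s → T s → _<ₚ_ P s (f i) → Σ (Fin (toℕ i)) λ j → s ≈ g j
      g-complete s Ts s<fi with complete s Ts (<-trans s<fi (proj₂ (below i)))
      ... | j , s≈fj with <-cmp j i
      ... | tri< j<i _ _ = fromℕ< j<i , subst (λ m → s ≈ f m) (≡.sym embed-j≡j) s≈fj
        where
        embed-j≡j : embed (fromℕ< j<i) ≡ j
        embed-j≡j = toℕ-injective (≡.trans (toℕ-embed (fromℕ< j<i)) (toℕ-fromℕ< j<i))
      ... | tri≈ _ j≡i _ = ⊥-elim (<⇒≉ s<fi (subst (λ m → s ≈ f m) j≡i s≈fj))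
      ... | tri> _ _ i<j = ⊥-elim (<⇒≱ s<fi (trans (proj₁ (increasing i j i<j)) (reflexive (Eq.sym s≈fj))))

    LevelOf-below : ∀ {n k t} → n ℕ.< k → HasHeight P T k t →
                    Σ Carrier λ s → LevelOf P T n s × s ≤ t
    LevelOf-below {n} n<k h@(f , below , _) =
      f i , (proj₁ (below i) , height-n) , proj₁ (proj₂ (below i))
      where
      i = fromℕ< n<k

      height-n : HasHeight P T n (f i)
      height-n = subst (λ m → HasHeight P T m (f i)) (toℕ-fromℕ< n<k) (HasHeight-predecessor h i)

    module _ (antichainLevels : ∀ n → IsAntichain P (LevelOf P T n)) where

      Compatible⇒≤ : ∀ {n k x z} → n ℕ.≤ k → LevelOf P T n x → LevelOf P T k z →
                     Compatible P x z → x ≤ z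
      Compatible⇒≤ {n} {x = x} {z} n≤k x∈Tₙ (Tz , hz) x∼z@(c , x≤c , z≤c) with m≤n⇒m<n∨m≡n n≤k
      ... | inj₂ ≡.refl = reflexive (antichainLevels n x z x∈Tₙ (Tz , hz) x∼z)
      ... | inj₁ n<k with LevelOf-below n<k hz
      ... | s , s∈Tₙ , s≤z =
        trans (reflexive (antichainLevels n x s x∈Tₙ s∈Tₙ (c , x≤c , trans s≤z z≤c))) s≤z

      IsIdeal⇒IsBranch : (∀ t → T t → Σ ℕ λ n → HasHeight P T n t) →
                         ∀ {D} → IsIdeal P D → (∀ n → Σ Carrier λ t → LevelOf P T n t × D t) →
                         IsBranch P T (T ∩ D)
      IsIdeal⇒IsBranch height {D} (directed , downClosed) meetsLevels =
        (proj₁ , comparable) , maximal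
        where
        compatible : ∀ x y → D x → D y → Compatible P x y
        compatible x y Dx Dy with directed x y Dx Dy
        ... | z , _ , x≤z , y≤z = z , x≤z , y≤z

        comparable : ∀ x y → (T ∩ D) x → (T ∩ D) y → x ≤ y ⊎ y ≤ x
        comparable x y (Tx , Dx) (Ty , Dy) with height x Tx | height y Ty
        ... | n , hx | m , hy with ≤-total n m
        ... | inj₁ n≤m = inj₁ (Compatible⇒≤ n≤m (Tx , hx) (Ty , hy) (compatible x y Dx Dy))
        ... | inj₂ m≤n = inj₂ (Compatible⇒≤ m≤n (Ty , hy) (Tx , hx) (compatible y x Dy Dx))

        maximal : ∀ J → IsChainIn P T J → T ∩ D ⊆ J → J ⊆ T ∩ D
        maximal J (J⊆T , Jcomparable) T∩D⊆J {j} Jj with height j (J⊆T Jj)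
        ... | k , hj with meetsLevels k
        ... | t , t∈Tₖ , Dt = J⊆T Jj , downClosed t j Dt (reflexive j≈t)
          where
          j∼t : Compatible P j t
          j∼t with Jcomparable j t Jj (T∩D⊆J (proj₁ t∈Tₖ , Dt))
          ... | inj₁ j≤t = t , j≤t , ≤-refl
          ... | inj₂ t≤j = j , ≤-refl , t≤j

          j≈t : j ≈ t
          j≈t = antichainLevels k j t (J⊆T Jj , hj) t∈Tₖ j∼t

  IsIdeal⇒GenBy⊆ : ∀ {D S} → IsIdeal P D → S ⊆ D → GenBy P S ⊆ D
  IsIdeal⇒GenBy⊆ (_ , downClosed) S⊆D (s , Ss , x≤s) = downClosed s _ (S⊆D Ss) x≤s

  module _ {u : ℕ → Carrier} (increasing : ∀ n → u n ≤ u (suc n)) where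

    increasing⇒monotone : ∀ {i j} → i ℕ.≤ j → u i ≤ u j
    increasing⇒monotone i≤j = go (≤⇒≤′ i≤j)
      where
      go : ∀ {i j} → i ℕ.≤′ j → u i ≤ u j
      go ℕ.≤′-refl      = ≤-refl
      go (ℕ.≤′-step p) = trans (go p) (increasing _)

    PlayIdeal-isIdeal : IsIdeal P (PlayIdeal P u)
    PlayIdeal-isIdeal = directed , λ x y (n , x≤uₙ) y≤x → n , trans y≤x x≤uₙ
      where
      directed : ∀ x y → PlayIdeal P u x → PlayIdeal P u y →
                 Σ Carrier λ z → PlayIdeal P u z × x ≤ z × y ≤ z
      directed x y (a , x≤uₐ) (b , y≤u_b) =
        u (a ℕ.+ b) , (a ℕ.+ b , ≤-refl) ,
        trans x≤uₐ (increasing⇒monotone (m≤m+n a b)) , trans y≤u_b (increasing⇒monotone (m≤n+m b a))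

    PlayIdeal-countablyGenerated : CountablyGeneratedIdeal P (PlayIdeal P u)
    PlayIdeal-countablyGenerated = PlayIdeal-isIdeal , Moves , countable , cofinal
      where
      Moves : Pred Carrier ℓ
      Moves c = Σ ℕ λ n → c ≡ u n

      countable : Countable P Moves
      countable = (λ n → just (u n)) , (λ { n _ ≡.refl → n , ≡.refl }) , (λ { _ (n , ≡.refl) → n , ≡.refl })

      cofinal : Cofinal P Moves (PlayIdeal P u)
      cofinal = (λ { (n , ≡.refl) → n , ≤-refl }) , λ x (n , x≤uₙ) → u n , (n , ≡.refl) , x≤uₙ

  module _ {A : ℕ → Pred Carrier ℓ} (predense : ∀ n → Predense (A n)) where

    meetingStrategy : OddStrategy P
    meetingStrategy = (λ n h → upperBound n (h (Fin.fromℕ (2 * n)))) ,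
                      (λ n h → last≤upperBound n (h (Fin.fromℕ (2 * n))))
      where
      upperBound : ℕ → Carrier → Carrier
      upperBound n p = proj₁ (proj₂ (proj₂ (predense n p)))

      last≤upperBound : ∀ n p → p ≤ upperBound n p
      last≤upperBound n p = proj₁ (proj₂ (proj₂ (proj₂ (predense n p))))

    meetingStrategy-meets : ∀ {u} → FollowsStrategy P meetingStrategy u →
                            ∀ n → Σ Carrier λ a → A n a × PlayIdeal P u a
    meetingStrategy-meets {u} (_ , oddMoves) n =
      a , a∈Aₙ , suc (2 * n) , subst (a ≤_) (≡.sym (oddMoves n)) a≤move
      where
      last = u (toℕ (Fin.fromℕ (2 * n)))
      a = proj₁ (predense n last)
      a∈Aₙ = proj₁ (proj₂ (predense n last))
      a≤move = proj₂ (proj₂ (proj₂ (proj₂ (predense n last))))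

mainTheorem2 : {ℓ ℓ' : Level} (P : Poset ℓ ℓ ℓ)
    (W : Pred (Pred (Poset.Carrier P) ℓ) ℓ') (T : Pred (Poset.Carrier P) ℓ) →
    (∀ I → W I → CountablyGeneratedIdeal P I) →
    IsMetricTree P T →
    (∀ (n : ℕ) → IsMaximalAntichain P (LevelOf P T n)) →
    (∀ I → IsBranch P T I → W (GenBy P I)) →
    IsFinalSegment P W →
    OddWins P W
mainTheorem2 P W T _ (height , _) maximalLevels branch∈W finalSegment =
  meetingStrategy P predenseLevels , wins
  where
  predenseLevels : ∀ n → Predense P (LevelOf P T n)
  predenseLevels n = IsMaximalAntichain⇒Predense P (maximalLevels n)

  wins : OddWinningStrategy P W (meetingStrategy P predenseLevels)
  wins u play@(increasing , _) =
    finalSegment (GenBy P branch) D (branch∈W branch isBranch)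
      (PlayIdeal-countablyGenerated P increasing) (IsIdeal⇒GenBy⊆ P D-isIdeal proj₂)
    where
    D = PlayIdeal P u
    branch = T ∩ D
    D-isIdeal = PlayIdeal-isIdeal P increasing
    isBranch : IsBranch P T branch
    isBranch = IsIdeal⇒IsBranch P (λ n → proj₁ (maximalLevels n)) height D-isIdeal
                 (meetingStrategy-meets P predenseLevels play)
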